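{- Let $U$ be a finite vertex set of a graph $G$, $R\subseteq V(G)$, $n_B=|\{x\in R:N(x)\cap U=B\}|$ for $B\subseteq U$, and $\rho_R=\sum_{B\subseteq U}n_B\mathbf 1_B\in\mathbb Z^U$. Let $m\ge0$, suppose $\rho_R$ is constant modulo $2^m$ on $U$, choose an integer $c$ with $\rho_R-c\mathbf 1_U\in2^m\mathbb Z^U$, and let $\Theta_m(R,U)=[(\rho_R-c\mathbf 1_U)/2^m \bmod 2]\in\mathbb F_2^U/\langle\mathbf 1_U\rangle$. Choose one representative $B$ from each complement orbit $\{B,U\setminus B\}$ other than $\{\varnothing,U\}$, and assume in addition that $n_B-n_{U\setminus B}$ is divisible by $2^m$ for every chosen representative $B$. Then \[\Theta_m(R,U)=\sum_{[B]}\Big(\tfrac{n_B-n_{U\setminus B}}{2^m}\pmod 2\Big)[\mathbf 1_B]\quad\text{in }\mathbb F_2^U/\langle\mathbf 1_U\rangle.\]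
   Context: $\mathbf 1_B$ is the indicator vector of $B$; $\mathbf 1_U$ the all-ones vector; the quotient is by constant vectors. ($\Theta_m$ does not depend on the choice of $c$.) -}

module Defs where

open import Data.Bool using (Bool; true; false; not; _∧_; _xor_; if_then_else_)
open import Data.Bool.Properties renaming (_≟_ to _≟ᵇ_)
open import Data.Nat as ℕ using (ℕ; zero; suc; _^_)
open import Data.Nat.Properties using (m^n≢0)
open import Data.Integer as ℤ using (ℤ; +_; _-_; _*_; _/ℕ_; _%ℕ_)
open import Data.Fin using (Fin; zero; suc)
open import Data.Fin.Subset using (Subset; inside; outside; ∁)
open import Data.Vec as Vec using (Vec; []; _∷_; tabulate; lookup)
open import Data.Vec.Properties using (≡-dec)
open import Data.List as List using (List; []; _∷_; _++_; length; filter; foldr)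
open import Relation.Binary.PropositionalEquality using (_≡_)
open import Relation.Nullary using (Dec)
open import Data.Sum using (_⊎_)

-- Enumeration of all subsets B ⊆ U (U identified with Fin k), each exactly once.
allSubsets : (k : ℕ) → List (Subset k)
allSubsets zero    = [] ∷ []
allSubsets (suc k) = List.map (outside ∷_) (allSubsets k) ++ List.map (inside ∷_) (allSubsets k)

_≟ˢ_ : {k : ℕ} (A B : Subset k) → Dec (A ≡ B)
_≟ˢ_ = ≡-dec _≟ᵇ_

record Graph (V : Set) : Set where
  field
    adj       : V → V → Bool
    symmetric : ∀ x y → adj x y ≡ adj y x
    loopless  : ∀ x → adj x x ≡ false
open Graph public

-- N(x) ∩ U as a subset of U, where U is given by an (injective) enumeration u : Fin k → V.
traceU : {V : Set} {k : ℕ} → Graph V → (Fin k → V) → V → Subset k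
traceU G u x = tabulate (λ i → adj G x (u i))

-- n_B = |{x ∈ R : N(x) ∩ U = B}|  (R given as a duplicate-free list of vertices)
nB : {V : Set} {k : ℕ} → Graph V → (Fin k → V) → List V → Subset k → ℕ
nB G u R B = length (filter (λ x → traceU G u x ≟ˢ B) R)

𝟙 : {k : ℕ} → Subset k → Fin k → ℤ
𝟙 B i = if lookup B i then + 1 else + 0

sumℤ : List ℤ → ℤ
sumℤ = foldr ℤ._+_ (+ 0)

ρ : {V : Set} {k : ℕ} → Graph V → (Fin k → V) → List V → Fin k → ℤ
ρ G u R i = sumℤ (List.map (λ B → + nB G u R B * 𝟙 B i) (allSubsets _))

parity : ℤ → Bool
parity z = (z %ℕ 2) ℕ.≡ᵇ 1

-- exact division by 2^m (used only when divisibility holds)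
_/2^_ : ℤ → ℕ → ℤ
z /2^ m = _/ℕ_ z (2 ^ m) {{m^n≢0 2 m}}

Θ : {V : Set} {k : ℕ} → Graph V → (Fin k → V) → List V → ℕ → ℤ → Fin k → Bool
Θ G u R m c i = parity ((ρ G u R i - c) /2^ m)

δ : {V : Set} {k : ℕ} → Graph V → (Fin k → V) → List V → Subset k → ℤ
δ G u R B = + nB G u R B - + nB G u R (∁ B)

-- Representative of Σ_{[B]} ((n_B - n_{U∖B})/2^m mod 2) [1_B] ∈ 𝔽₂^U,
-- the sum ranging over the chosen representatives (chosen B ≡ true).
orbitSum : {V : Set} {k : ℕ} → Graph V → (Fin k → V) → List V → ℕ →
           (Subset k → Bool) → Fin k → Bool
orbitSum G u R m chosen i =
  foldr _xor_ false
    (List.map (λ B → chosen B ∧ (parity (δ G u R B /2^ m) ∧ lookup B i)) (allSubsets _))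

-- equality in 𝔽₂^U / ⟨1_U⟩
_≈₁_ : {k : ℕ} → (Fin k → Bool) → (Fin k → Bool) → Set
v ≈₁ w = (∀ i → v i ≡ w i) ⊎ (∀ i → v i ≡ not (w i))

-- Split ρ_R = Σ_B n_B 1_B along complement orbits. A chosen B and its complement contribute
-- n_B 1_B + n_{U∖B} (1_U − 1_B) = n_{U∖B} 1_U + (n_B − n_{U∖B}) 1_B, and the orbit {∅, U}
-- contributes n_U 1_U. Hence ρ_R − c = D 1_U + 2^m t with D an integer and
-- t = Σ_{[B]} ((n_B − n_{U∖B})/2^m) 1_B, so (ρ_R − c)/2^m ≡ t mod 2 up to a multiple of 1_U.
module Submission where

open import Defs
open import Algebra.Bundles using (AbelianGroup)
open import Algebra.Properties.Group using (∙-cancelʳ)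
open import Data.Bool using (Bool; true; false; not; _∧_; _∨_; _xor_; if_then_else_)
open import Data.Bool.Properties using (not-involutive; not-¬; ∧-identityʳ; ∧-zeroʳ)
open import Data.Nat as ℕ using (ℕ; zero; suc; _^_)
open import Data.Nat.Properties using (m^n≢0)
open import Data.Nat.DivMod using (m<n⇒m%n≡m)
open import Data.Integer as ℤ using (ℤ; +_; _+_; _*_; _-_; _/ℕ_; _%ℕ_; _<_; +<+)
open import Data.Integer.Properties
  using (+-0-abelianGroup; +-comm; +-assoc; +-identityˡ; +-identityʳ; *-distribʳ-+;
         *-identityʳ; *-zeroʳ; +-injective; <-cmp; <-irrefl; +-monoˡ-<; suc-*;
         *-monoʳ-≤-nonNeg; i<j⇒suc[i]≤j; i≤j+i; module ≤-Reasoning)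
open import Data.Integer.DivMod using (n%ℕd<d; a≡a%ℕn+[a/ℕn]*n)
open import Data.Integer.Divisibility using (_∣_)
open import Data.Integer.Divisibility.Signed using (∣ᵤ⇒∣; divides)
open import Data.Integer.Tactic.RingSolver using (solve-∀)
open import Data.Fin using (Fin; zero; suc)
open import Data.Fin.Subset using (Subset; ∁; ⊥; ⊤; inside; outside)
open import Data.Vec using (_∷_; lookup)
open import Data.Vec.Properties as Vec using (lookup-map; lookup-replicate)
open import Data.List as List using (List; []; _∷_; _++_; foldr)
open import Data.List.Properties using (map-++; map-cong; map-∘)
open import Data.List.Relation.Unary.Unique.Propositional using (Unique)
open import Data.Product using (_×_; _,_; proj₁; proj₂)
open import Data.Sum using (_⊎_; inj₁; inj₂)
open import Data.Empty using (⊥-elim)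
open import Function using (_∘_)
open import Function.Definitions using (Injective)
open import Relation.Binary.Definitions using (tri<; tri≈; tri>)
open import Relation.Binary.PropositionalEquality
open import Relation.Nullary using (yes; no)

-- Euclidean division of integers by a positive natural number

module _ (d : ℕ) .{{_ : ℕ.NonZero d}} where

  private
    r+q*d<r'+q'*d : ∀ {r r' q q'} → r ℕ.< d → q < q' → + r + q * + d < + r' + q' * + d
    r+q*d<r'+q'*d {r} {r'} {q} {q'} r<d q<q' = begin-strict
      + r + q * + d   <⟨ +-monoˡ-< (q * + d) (+<+ r<d) ⟩
      + d + q * + d   ≡⟨ suc-* q (+ d) ⟨
      ℤ.suc q * + d   ≤⟨ *-monoʳ-≤-nonNeg (+ d) (i<j⇒suc[i]≤j q<q') ⟩
      q' * + d        ≤⟨ i≤j+i (q' * + d) (+ r') ⟩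
      + r' + q' * + d ∎
      where open ≤-Reasoning

  divMod-unique : ∀ {r r' q q'} → r ℕ.< d → r' ℕ.< d →
                  + r + q * + d ≡ + r' + q' * + d → r ≡ r' × q ≡ q'
  divMod-unique {r} {r'} {q} {q'} r<d r'<d eq with <-cmp q q'
  ... | tri< q<q' _ _ = ⊥-elim (<-irrefl eq (r+q*d<r'+q'*d r<d q<q'))
  ... | tri> _ _ q>q' = ⊥-elim (<-irrefl (sym eq) (r+q*d<r'+q'*d r'<d q>q'))
  ... | tri≈ _ refl _ = +-injective (+-cancelʳ (q * + d) (+ r) (+ r') eq) , refl
    where +-cancelʳ = ∙-cancelʳ (AbelianGroup.group +-0-abelianGroup)

  private
    shifted-decomposition : ∀ x q →
      + (x %ℕ d) + (x /ℕ d + q) * + d ≡ + ((x + q * + d) %ℕ d) + ((x + q * + d) /ℕ d) * + d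
    shifted-decomposition x q = begin
      + (x %ℕ d) + (x /ℕ d + q) * + d         ≡⟨ regroup (+ (x %ℕ d)) (x /ℕ d) q (+ d) ⟩
      (+ (x %ℕ d) + x /ℕ d * + d) + q * + d   ≡⟨ cong (_+ q * + d) (a≡a%ℕn+[a/ℕn]*n x d) ⟨
      x + q * + d                             ≡⟨ a≡a%ℕn+[a/ℕn]*n (x + q * + d) d ⟩
      + ((x + q * + d) %ℕ d) + ((x + q * + d) /ℕ d) * + d ∎
      where
      open ≡-Reasoning
      regroup : ∀ r a q e → r + (a + q) * e ≡ (r + a * e) + q * e
      regroup = solve-∀

    divMod-shift : ∀ x q → x %ℕ d ≡ (x + q * + d) %ℕ d × x /ℕ d + q ≡ (x + q * + d) /ℕ d
    divMod-shift x q = divMod-unique (n%ℕd<d x d) (n%ℕd<d (x + q * + d) d) (shifted-decomposition x q)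

  [x+q*d]/ℕd≡x/ℕd+q : ∀ x q → (x + q * + d) /ℕ d ≡ x /ℕ d + q
  [x+q*d]/ℕd≡x/ℕd+q x q = sym (proj₂ (divMod-shift x q))

  [x+q*d]%ℕd≡x%ℕd : ∀ x q → (x + q * + d) %ℕ d ≡ x %ℕ d
  [x+q*d]%ℕd≡x%ℕd x q = sym (proj₁ (divMod-shift x q))

  [q*d]/ℕd≡q : ∀ q → (q * + d) /ℕ d ≡ q
  [q*d]/ℕd≡q q = sym (proj₂ (divMod-unique (ℕ.>-nonZero⁻¹ d) (n%ℕd<d (q * + d) d)
    (trans (+-identityˡ (q * + d)) (a≡a%ℕn+[a/ℕn]*n (q * + d) d))))

parity-digits : ∀ {r s} → r ℕ.< 2 → s ℕ.< 2 → parity (+ r + + s) ≡ parity (+ r) xor parity (+ s)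
parity-digits {0} {0} _ _ = refl
parity-digits {0} {1} _ _ = refl
parity-digits {1} {0} _ _ = refl
parity-digits {1} {1} _ _ = refl
parity-digits {suc (suc _)} (ℕ.s≤s (ℕ.s≤s ()))
parity-digits {_} {suc (suc _)} _ (ℕ.s≤s (ℕ.s≤s ()))

parity-remainder : ∀ x → parity (+ (x %ℕ 2)) ≡ parity x
parity-remainder x = cong (ℕ._≡ᵇ 1) (m<n⇒m%n≡m (n%ℕd<d x 2))

parity-+ : ∀ x y → parity (x + y) ≡ parity x xor parity y
parity-+ x y = begin
  parity (x + y)                ≡⟨ cong parity digits ⟩
  parity (+ r + + s + q * + 2)  ≡⟨ cong (ℕ._≡ᵇ 1) ([x+q*d]%ℕd≡x%ℕd 2 (+ r + + s) q) ⟩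
  parity (+ r + + s)            ≡⟨ parity-digits (n%ℕd<d x 2) (n%ℕd<d y 2) ⟩
  parity (+ r) xor parity (+ s) ≡⟨ cong₂ _xor_ (parity-remainder x) (parity-remainder y) ⟩
  parity x xor parity y         ∎
  where
  open ≡-Reasoning
  r s : ℕ
  r = x %ℕ 2
  s = y %ℕ 2
  q : ℤ
  q = x /ℕ 2 + y /ℕ 2
  interleave : ∀ r s a b e → (r + a * e) + (s + b * e) ≡ (r + s) + (a + b) * e
  interleave = solve-∀
  digits : x + y ≡ + r + + s + q * + 2
  digits = trans (cong₂ _+_ (a≡a%ℕn+[a/ℕn]*n x 2) (a≡a%ℕn+[a/ℕn]*n y 2))
                 (interleave (+ r) (+ s) (x /ℕ 2) (y /ℕ 2) (+ 2))

parity-sumℤ : ∀ xs → parity (sumℤ xs) ≡ foldr _xor_ false (List.map parity xs)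
parity-sumℤ []       = refl
parity-sumℤ (x ∷ xs) = trans (parity-+ x (sumℤ xs)) (cong (_xor_ (parity x)) (parity-sumℤ xs))

parity-*-if : ∀ z b → parity (z * (if b then + 1 else + 0)) ≡ parity z ∧ b
parity-*-if z true  = trans (cong parity (*-identityʳ z)) (sym (∧-identityʳ (parity z)))
parity-*-if z false = trans (cong parity (*-zeroʳ z)) (sym (∧-zeroʳ (parity z)))

[_]·_ : Bool → ℤ → ℤ
[ b ]· z = if b then z else + 0

parity-[]· : ∀ b z → parity ([ b ]· z) ≡ b ∧ parity z
parity-[]· true  z = refl
parity-[]· false z = refl

[]·-+ : ∀ b x y → [ b ]· (x + y) ≡ [ b ]· x + [ b ]· y
[]·-+ true  x y = refl
[]·-+ false x y = refl

split-disjoint : ∀ b c → b ∧ c ≡ false →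
                 ∀ z → z ≡ [ b ]· z + [ c ]· z + [ not (b ∨ c) ]· z
split-disjoint true  false _ z = sym (trans (+-identityʳ (z + + 0)) (+-identityʳ z))
split-disjoint false true  _ z = sym (trans (+-identityʳ (+ 0 + z)) (+-identityˡ z))
split-disjoint false false _ z = sym (+-identityˡ z)

sumℤ-++ : ∀ xs ys → sumℤ (xs ++ ys) ≡ sumℤ xs + sumℤ ys
sumℤ-++ []       ys = sym (+-identityˡ (sumℤ ys))
sumℤ-++ (x ∷ xs) ys = trans (cong (_+_ x) (sumℤ-++ xs ys)) (sym (+-assoc x (sumℤ xs) (sumℤ ys)))

module _ {A : Set} where

  sumℤ-map-+ : ∀ (f g : A → ℤ) xs →
               sumℤ (List.map (λ x → f x + g x) xs) ≡ sumℤ (List.map f xs) + sumℤ (List.map g xs)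
  sumℤ-map-+ f g []       = refl
  sumℤ-map-+ f g (x ∷ xs) = trans (cong (_+_ (f x + g x)) (sumℤ-map-+ f g xs))
                                  (medial (f x) (g x) (sumℤ (List.map f xs)) (sumℤ (List.map g xs)))
    where
    medial : ∀ a b c e → (a + b) + (c + e) ≡ (a + c) + (b + e)
    medial = solve-∀

  sumℤ-map-*ʳ : ∀ (f : A → ℤ) z xs →
                sumℤ (List.map (λ x → f x * z) xs) ≡ sumℤ (List.map f xs) * z
  sumℤ-map-*ʳ f z []       = refl
  sumℤ-map-*ʳ f z (x ∷ xs) = trans (cong (_+_ (f x * z)) (sumℤ-map-*ʳ f z xs))
                                   (sym (*-distribʳ-+ z (f x) (sumℤ (List.map f xs))))

∁-involutive : ∀ {k} (B : Subset k) → ∁ (∁ B) ≡ B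
∁-involutive B = trans (sym (Vec.map-∘ not not B)) (trans (Vec.map-cong not-involutive B) (Vec.map-id B))

∑ : {k : ℕ} → (Subset k → ℤ) → ℤ
∑ f = sumℤ (List.map f (allSubsets _))

module _ {k : ℕ} where

  ∑-cong : {f g : Subset k → ℤ} → (∀ B → f B ≡ g B) → ∑ f ≡ ∑ g
  ∑-cong f≗g = cong sumℤ (map-cong f≗g (allSubsets k))

  ∑-+ : ∀ (f g : Subset k → ℤ) → ∑ (λ B → f B + g B) ≡ ∑ f + ∑ g
  ∑-+ f g = sumℤ-map-+ f g (allSubsets k)

  ∑-*ʳ : ∀ (f : Subset k → ℤ) z → ∑ (λ B → f B * z) ≡ ∑ f * z
  ∑-*ʳ f z = sumℤ-map-*ʳ f z (allSubsets k)

∑-split-head : ∀ {k} (f : Subset (suc k) → ℤ) →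
               ∑ f ≡ ∑ (f ∘ (outside ∷_)) + ∑ (f ∘ (inside ∷_))
∑-split-head {k} f = begin
  sumℤ (List.map f (List.map (outside ∷_) L ++ List.map (inside ∷_) L))
    ≡⟨ cong sumℤ (map-++ f (List.map (outside ∷_) L) _) ⟩
  sumℤ (List.map f (List.map (outside ∷_) L) ++ List.map f (List.map (inside ∷_) L))
    ≡⟨ sumℤ-++ (List.map f (List.map (outside ∷_) L)) _ ⟩
  sumℤ (List.map f (List.map (outside ∷_) L)) + sumℤ (List.map f (List.map (inside ∷_) L))
    ≡⟨ cong₂ (λ xs ys → sumℤ xs + sumℤ ys) (map-∘ L) (map-∘ L) ⟨
  ∑ (f ∘ (outside ∷_)) + ∑ (f ∘ (inside ∷_)) ∎
  where
  open ≡-Reasoning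
  L = allSubsets k

∑-∁ : ∀ {k} (f : Subset k → ℤ) → ∑ (f ∘ ∁) ≡ ∑ f
∑-∁ {zero}  f = refl
∑-∁ {suc k} f = begin
  ∑ (f ∘ ∁)
    ≡⟨ ∑-split-head (f ∘ ∁) ⟩
  ∑ (f ∘ (inside ∷_) ∘ ∁) + ∑ (f ∘ (outside ∷_) ∘ ∁)
    ≡⟨ cong₂ _+_ (∑-∁ (f ∘ (inside ∷_))) (∑-∁ (f ∘ (outside ∷_))) ⟩
  ∑ (f ∘ (inside ∷_)) + ∑ (f ∘ (outside ∷_))
    ≡⟨ +-comm (∑ (f ∘ (inside ∷_))) _ ⟩
  ∑ (f ∘ (outside ∷_)) + ∑ (f ∘ (inside ∷_))
    ≡⟨ ∑-split-head f ⟨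
  ∑ f ∎
  where open ≡-Reasoning

∑-∁-swap : ∀ {k} (F : Subset k → Subset k → ℤ) →
           ∑ (λ B → F (∁ B) B) ≡ ∑ (λ B → F B (∁ B))
∑-∁-swap F = trans (∑-cong (λ B → cong (F (∁ B)) (sym (∁-involutive B))))
                   (∑-∁ (λ B → F B (∁ B)))

𝟙-∁ : ∀ {k} (B : Subset k) i → 𝟙 (∁ B) i ≡ + 1 - 𝟙 B i
𝟙-∁ B i rewrite lookup-map i not B with lookup B i
... | true  = refl
... | false = refl

𝟙-⊥ : ∀ {k} (i : Fin k) → 𝟙 ⊥ i ≡ + 0
𝟙-⊥ i rewrite lookup-replicate i outside = refl

𝟙-⊤ : ∀ {k} (i : Fin k) → 𝟙 ⊤ i ≡ + 1
𝟙-⊤ i rewrite lookup-replicate i inside = refl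

complement-pair : ∀ {k} x y (B : Subset k) i →
                  x * 𝟙 B i + y * 𝟙 (∁ B) i ≡ y + (x - y) * 𝟙 B i
complement-pair x y B i = trans (cong (λ a → x * 𝟙 B i + y * a) (𝟙-∁ B i)) (regroup x y (𝟙 B i))
  where
  regroup : ∀ x y a → x * a + y * (+ 1 - a) ≡ y + (x - y) * a
  regroup = solve-∀

𝟙-trivial-orbit : ∀ {k} {B : Subset k} → B ≡ ⊥ ⊎ B ≡ ⊤ → ∀ i j → 𝟙 B i ≡ 𝟙 B j
𝟙-trivial-orbit (inj₁ refl) i j = trans (𝟙-⊥ i) (sym (𝟙-⊥ j))
𝟙-trivial-orbit (inj₂ refl) i j = trans (𝟙-⊤ i) (sym (𝟙-⊤ j))

xor≡true⇒∧≡false : ∀ b c → b xor c ≡ true → b ∧ c ≡ false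
xor≡true⇒∧≡false true  false _ = refl
xor≡true⇒∧≡false false c     _ = refl

xor≡true⇒∨≡true : ∀ b c → b xor c ≡ true → b ∨ c ≡ true
xor≡true⇒∨≡true true  c _  = refl
xor≡true⇒∨≡true false c eq = eq

module Representatives {k : ℕ} (chosen : Subset k → Bool)
  (chosen-⊥ : chosen ⊥ ≡ false) (chosen-⊤ : chosen ⊤ ≡ false)
  (one-per-orbit : ∀ B → B ≢ ⊥ → B ≢ ⊤ → (chosen B xor chosen (∁ B)) ≡ true) where

  orbit-cases : ∀ B → (B ≡ ⊥ ⊎ B ≡ ⊤) ⊎ (chosen B xor chosen (∁ B)) ≡ true
  orbit-cases B with B ≟ˢ ⊥ | B ≟ˢ ⊤
  ... | yes B≡⊥ | _       = inj₁ (inj₁ B≡⊥)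
  ... | no _    | yes B≡⊤ = inj₁ (inj₂ B≡⊤)
  ... | no B≢⊥  | no B≢⊤  = inj₂ (one-per-orbit B B≢⊥ B≢⊤)

  unrepresented : Subset k → Bool
  unrepresented B = not (chosen B ∨ chosen (∁ B))

  chosen-disjoint-∁ : ∀ B → chosen B ∧ chosen (∁ B) ≡ false
  chosen-disjoint-∁ B with orbit-cases B
  ... | inj₁ (inj₁ refl) = cong (_∧ chosen (∁ ⊥)) chosen-⊥
  ... | inj₁ (inj₂ refl) = cong (_∧ chosen (∁ ⊤)) chosen-⊤
  ... | inj₂ one         = xor≡true⇒∧≡false (chosen B) (chosen (∁ B)) one

  unrepresented⇒trivial : ∀ B → unrepresented B ≡ true → B ≡ ⊥ ⊎ B ≡ ⊤
  unrepresented⇒trivial B eq with orbit-cases B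
  ... | inj₁ trivial = trivial
  ... | inj₂ one     =
    ⊥-elim (not-¬ (sym (xor≡true⇒∨≡true (chosen B) (chosen (∁ B)) one)) (sym eq))

-- The orbit decomposition of ρ_R

module OrbitDecomposition {V : Set} (G : Graph V) {k : ℕ} (u : Fin k → V) (R : List V)
  (chosen : Subset k → Bool)
  (chosen-⊥ : chosen ⊥ ≡ false) (chosen-⊤ : chosen ⊤ ≡ false)
  (one-per-orbit : ∀ B → B ≢ ⊥ → B ≢ ⊤ → (chosen B xor chosen (∁ B)) ≡ true) where

  open Representatives chosen chosen-⊥ chosen-⊤ one-per-orbit

  n : Subset k → ℤ
  n B = + nB G u R B

  contribution : Fin k → Subset k → ℤ
  contribution i B = n B * 𝟙 B i

  constant-part : ℤ
  constant-part = ∑ (λ B → [ chosen B ]· n (∁ B))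

  trivial-part : Fin k → ℤ
  trivial-part i = ∑ (λ B → [ unrepresented B ]· contribution i B)

  orbit-part : Fin k → ℤ
  orbit-part i = ∑ (λ B → [ chosen B ]· (δ G u R B * 𝟙 B i))

  representative-pair : ∀ i B →
    [ chosen B ]· contribution i B + [ chosen B ]· contribution i (∁ B) ≡
    [ chosen B ]· n (∁ B) + [ chosen B ]· (δ G u R B * 𝟙 B i)
  representative-pair i B = begin
    [ chosen B ]· contribution i B + [ chosen B ]· contribution i (∁ B)
      ≡⟨ []·-+ (chosen B) (contribution i B) (contribution i (∁ B)) ⟨
    [ chosen B ]· (contribution i B + contribution i (∁ B))
      ≡⟨ cong ([ chosen B ]·_) (complement-pair (n B) (n (∁ B)) B i) ⟩
    [ chosen B ]· (n (∁ B) + δ G u R B * 𝟙 B i)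
      ≡⟨ []·-+ (chosen B) (n (∁ B)) (δ G u R B * 𝟙 B i) ⟩
    [ chosen B ]· n (∁ B) + [ chosen B ]· (δ G u R B * 𝟙 B i) ∎
    where open ≡-Reasoning

  ρ≡constant+orbit+trivial : ∀ i → ρ G u R i ≡ constant-part + orbit-part i + trivial-part i
  ρ≡constant+orbit+trivial i = begin
    ∑ a
      ≡⟨ ∑-cong (λ B → split-disjoint (chosen B) (chosen (∁ B)) (chosen-disjoint-∁ B) (a B)) ⟩
    ∑ (λ B → [ chosen B ]· a B + [ chosen (∁ B) ]· a B + [ unrepresented B ]· a B)
      ≡⟨ ∑-+ (λ B → [ chosen B ]· a B + [ chosen (∁ B) ]· a B) _ ⟩
    ∑ (λ B → [ chosen B ]· a B + [ chosen (∁ B) ]· a B) + trivial-part i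
      ≡⟨ cong (_+ trivial-part i) (∑-+ (λ B → [ chosen B ]· a B) _) ⟩
    ∑ (λ B → [ chosen B ]· a B) + ∑ (λ B → [ chosen (∁ B) ]· a B) + trivial-part i
      ≡⟨ cong (λ s → ∑ (λ B → [ chosen B ]· a B) + s + trivial-part i)
              (∑-∁-swap (λ C B → [ chosen C ]· a B)) ⟩
    ∑ (λ B → [ chosen B ]· a B) + ∑ (λ B → [ chosen B ]· a (∁ B)) + trivial-part i
      ≡⟨ cong (_+ trivial-part i) (∑-+ (λ B → [ chosen B ]· a B) _) ⟨
    ∑ (λ B → [ chosen B ]· a B + [ chosen B ]· a (∁ B)) + trivial-part i
      ≡⟨ cong (_+ trivial-part i) (∑-cong (representative-pair i)) ⟩
    ∑ (λ B → [ chosen B ]· n (∁ B) + [ chosen B ]· (δ G u R B * 𝟙 B i)) + trivial-part i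
      ≡⟨ cong (_+ trivial-part i) (∑-+ (λ B → [ chosen B ]· n (∁ B)) _) ⟩
    constant-part + orbit-part i + trivial-part i ∎
    where
    open ≡-Reasoning
    a : Subset k → ℤ
    a = contribution i

  trivial-part-constant : ∀ i j → trivial-part i ≡ trivial-part j
  trivial-part-constant i j = ∑-cong term
    where
    term : ∀ B → [ unrepresented B ]· contribution i B ≡ [ unrepresented B ]· contribution j B
    term B with unrepresented B in eq
    ... | false = refl
    ... | true  = cong (n B *_) (𝟙-trivial-orbit (unrepresented⇒trivial B eq) i j)

  ρ-orbit-part-constant : ∀ i j → ρ G u R i - orbit-part i ≡ ρ G u R j - orbit-part j
  ρ-orbit-part-constant i j = begin
    ρ G u R i - orbit-part i ≡⟨ remainder i ⟩
    constant-part + trivial-part i ≡⟨ cong (_+_ constant-part) (trivial-part-constant i j) ⟩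
    constant-part + trivial-part j ≡⟨ remainder j ⟨
    ρ G u R j - orbit-part j ∎
    where
    open ≡-Reasoning
    cancel : ∀ x y z → x + y + z - y ≡ x + z
    cancel = solve-∀
    remainder : ∀ i → ρ G u R i - orbit-part i ≡ constant-part + trivial-part i
    remainder i = trans (cong (_- orbit-part i) (ρ≡constant+orbit+trivial i))
                        (cancel constant-part (orbit-part i) (trivial-part i))

  module _ (m : ℕ) (2^m∣δ : ∀ B → chosen B ≡ true → (+ (2 ^ m)) ∣ δ G u R B) where

    private instance
      2^m-nonZero : ℕ.NonZero (2 ^ m)
      2^m-nonZero = m^n≢0 2 m

    halved-δ : Subset k → ℤ
    halved-δ B = δ G u R B /2^ m

    halved-orbit-part : Fin k → ℤ
    halved-orbit-part i = ∑ (λ B → [ chosen B ]· (halved-δ B * 𝟙 B i))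

    δ≡halved-δ*2^m : ∀ B → chosen B ≡ true → δ G u R B ≡ halved-δ B * + (2 ^ m)
    δ≡halved-δ*2^m B chosen-B with ∣ᵤ⇒∣ {+ (2 ^ m)} {δ G u R B} (2^m∣δ B chosen-B)
    ... | divides q δ≡q*2^m = begin
      δ G u R B                       ≡⟨ δ≡q*2^m ⟩
      q * + (2 ^ m)                   ≡⟨ cong (_* + (2 ^ m)) ([q*d]/ℕd≡q (2 ^ m) q) ⟨
      (q * + (2 ^ m)) /2^ m * + (2 ^ m) ≡⟨ cong (λ x → x /2^ m * + (2 ^ m)) δ≡q*2^m ⟨
      halved-δ B * + (2 ^ m)          ∎
      where open ≡-Reasoning

    orbit-part≡halved*2^m : ∀ i → orbit-part i ≡ halved-orbit-part i * + (2 ^ m)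
    orbit-part≡halved*2^m i =
      trans (∑-cong term) (∑-*ʳ (λ B → [ chosen B ]· (halved-δ B * 𝟙 B i)) (+ (2 ^ m)))
      where
      regroup : ∀ q d a → q * d * a ≡ q * a * d
      regroup = solve-∀
      term : ∀ B → [ chosen B ]· (δ G u R B * 𝟙 B i) ≡
                   [ chosen B ]· (halved-δ B * 𝟙 B i) * + (2 ^ m)
      term B with chosen B in chosen-B
      ... | false = refl
      ... | true  = trans (cong (_* 𝟙 B i) (δ≡halved-δ*2^m B chosen-B))
                          (regroup (halved-δ B) (+ (2 ^ m)) (𝟙 B i))

    parity-halved-orbit-part : ∀ i → parity (halved-orbit-part i) ≡ orbitSum G u R m chosen i
    parity-halved-orbit-part i = begin
      parity (sumℤ (List.map f L))               ≡⟨ parity-sumℤ (List.map f L) ⟩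
      foldr _xor_ false (List.map parity (List.map f L)) ≡⟨ cong (foldr _xor_ false) (map-∘ L) ⟨
      foldr _xor_ false (List.map (parity ∘ f) L) ≡⟨ cong (foldr _xor_ false) (map-cong term L) ⟩
      orbitSum G u R m chosen i                  ∎
      where
      open ≡-Reasoning
      L = allSubsets k
      f : Subset k → ℤ
      f B = [ chosen B ]· (halved-δ B * 𝟙 B i)
      term : ∀ B → parity (f B) ≡ chosen B ∧ (parity (halved-δ B) ∧ lookup B i)
      term B = trans (parity-[]· (chosen B) (halved-δ B * 𝟙 B i))
                     (cong (chosen B ∧_) (parity-*-if (halved-δ B) (lookup B i)))

    Θ≡offset-xor-orbitSum : ∀ c i →
      Θ G u R m c i ≡ parity ((ρ G u R i - orbit-part i - c) /2^ m) xor orbitSum G u R m chosen i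
    Θ≡offset-xor-orbitSum c i = begin
      parity ((ρ G u R i - c) /2^ m)
        ≡⟨ cong (λ x → parity (x /2^ m)) split ⟩
      parity ((offset + halved-orbit-part i * + (2 ^ m)) /2^ m)
        ≡⟨ cong parity ([x+q*d]/ℕd≡x/ℕd+q (2 ^ m) offset (halved-orbit-part i)) ⟩
      parity (offset /2^ m + halved-orbit-part i)
        ≡⟨ parity-+ (offset /2^ m) (halved-orbit-part i) ⟩
      parity (offset /2^ m) xor parity (halved-orbit-part i)
        ≡⟨ cong (_xor_ (parity (offset /2^ m))) (parity-halved-orbit-part i) ⟩
      parity (offset /2^ m) xor orbitSum G u R m chosen i ∎
      where
      open ≡-Reasoning
      offset : ℤ
      offset = ρ G u R i - orbit-part i - c
      regroup : ∀ r t c → r - c ≡ (r - t - c) + t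
      regroup = solve-∀
      split : ρ G u R i - c ≡ offset + halved-orbit-part i * + (2 ^ m)
      split = trans (regroup (ρ G u R i) (orbit-part i) c)
                    (cong (_+_ offset) (orbit-part≡halved*2^m i))

≈₁-by-offset : ∀ {k} {v w : Fin k → Bool} b → (∀ i → v i ≡ b xor w i) → v ≈₁ w
≈₁-by-offset false v≡w  = inj₁ v≡w
≈₁-by-offset true  v≡¬w = inj₂ v≡¬w

≈₁-by-constant-offset : ∀ {k} {v w : Fin k → Bool} (b : Fin k → Bool) → (∀ i j → b i ≡ b j) →
                        (∀ i → v i ≡ b i xor w i) → v ≈₁ w
≈₁-by-constant-offset {zero}  b _ _ = inj₁ (λ ())
≈₁-by-constant-offset {suc k} {w = w} b b-constant v≡b+w =
  ≈₁-by-offset (b zero) (λ i → trans (v≡b+w i) (cong (_xor w i) (b-constant i zero)))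

mainTheorem4 : {V : Set} (G : Graph V) (k : ℕ) (u : Fin k → V) → Injective _≡_ _≡_ u →
    (R : List V) → Unique R → (m : ℕ) → (c : ℤ) →
    (∀ i → (+ (2 ^ m)) ∣ (ρ G u R i - c)) →
    (chosen : Subset k → Bool) →
    chosen ⊥ ≡ false → chosen ⊤ ≡ false →
    (∀ B → B ≢ ⊥ → B ≢ ⊤ → (chosen B xor chosen (∁ B)) ≡ true) →
    (∀ B → chosen B ≡ true → (+ (2 ^ m)) ∣ δ G u R B) →
    Θ G u R m c ≈₁ orbitSum G u R m chosen
mainTheorem4 G k u _ R _ m c _ chosen chosen-⊥ chosen-⊤ one-per-orbit 2^m∣δ =
  ≈₁-by-constant-offset (λ i → parity ((ρ G u R i - orbit-part i - c) /2^ m))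
    (λ i j → cong (λ x → parity ((x - c) /2^ m)) (ρ-orbit-part-constant i j))
    (Θ≡offset-xor-orbitSum m 2^m∣δ c)
  where open OrbitDecomposition G u R chosen chosen-⊥ chosen-⊤ one-per-orbit
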